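{- Let $\phi=\forall x_1,\ldots,x_t\,\neg\phi_0(\bar x)\wedge\bigwedge_{i=1}^m\forall x\exists\bar y\,\phi_i(x,\bar y)$ be a \mbox{UNFO}{+}\mbox{EQ} formula in Scott-normal form and let $\mathfrak A$ be a model of $\phi$ (in which all symbols of $\sigma_{dist}$ are equivalences). Let $\mathfrak A'$ be a structure over the same signature in which all relations from $\sigma_{dist}$ are equivalences, such that (1) for every $a'\in A'$ there is a $\phi$-witness structure for $a'$ in $\mathfrak A'$; and (2) for every tuple $a'_1,\ldots,a'_t$ of elements of $A'$ there is a homomorphism $\mathfrak h:\mathfrak A'\restriction\{a'_1,\ldots,a'_t\}\to\mathfrak A$ which preserves the atomic $1$-types of elements. Then $\mathfrak A'\models\phi$.
   Context: Signatures are purely relational, $\sigma=\sigma_{base}\cup\sigma_{dist}$, with all symbols of $\sigma_{dist}$ binary. \mbox{UNFO} is given by the grammar $\phi ::= R(\bar x)\mid x=y\mid \phi\wedge\phi\mid\phi\vee\phi\mid\exists x\,\phi\mid\neg\phi(x)$, where in the last clause $\phi$ has at most $x$ free; $\forall\bar x\neg\phi$ abbreviates $\neg\exists\bar x\,\phi$. \mbox{UNFO}{+}\mbox{EQ} has the same syntax, with admissible models interpreting each symbol of $\sigma_{dist}$ as an equivalence. Scott-normal form means the displayed shape with each $\phi_i$ ($0\le i\le m$) a quantifier-free \mbox{UNFO}{+}\mbox{EQ} formula. Given elements $a,\bar b$ with $\mathfrak A\models\phi_i(a,\bar b)$, $\mathfrak A\restriction\{a,\bar b\}$ is a witness structure for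 $a$ and $\phi_i$; choosing one witness structure $\mathfrak W_i$ for $a$ and each $i=1,\ldots,m$, the structure $\mathfrak A\restriction(W_1\cup\cdots\cup W_m)$ is a $\phi$-witness structure for $a$. The atomic $1$-type of an element is the set of literals (atoms and negated atoms) in one variable it satisfies. -}

module Defs where

open import Data.Nat using (ℕ; zero; suc; _≤_)
open import Data.Fin using (Fin)
open import Data.Vec.Functional using (Vector; _∷_)
open import Data.Product using (Σ; ∃; _×_; _,_)
open import Data.Sum using (_⊎_)
open import Data.Empty using (⊥)
open import Relation.Nullary using (¬_)
open import Relation.Binary.PropositionalEquality using (_≡_; cong)
open import Relation.Binary using (IsEquivalence)
open import Function using (_∘_)
open import Function.Bundles using (_⇔_)

record Sig : Set₁ where
  field
    BSym  : Set
    arity : BSym → ℕ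
    DSym  : Set
    arity-pos : (R : BSym) → 1 ≤ arity R
open Sig public

record Structure (σ : Sig) : Set₁ where
  field
    Carrier : Set
    relB    : (R : BSym σ) → (Fin (arity σ R) → Carrier) → Set
    relD    : DSym σ → Carrier → Carrier → Set
    -- relations are sets of tuples: membership depends only on the entries
    relB-ext : (R : BSym σ) (v w : Fin (arity σ R) → Carrier) →
               ((j : Fin (arity σ R)) → v j ≡ w j) → relB R v → relB R w
open Structure public

Admissible : {σ : Sig} → Structure σ → Set
Admissible {σ} A = (E : DSym σ) → IsEquivalence (relD A E)

_↾_ : {σ : Sig} (A : Structure σ) → (Carrier A → Set) → Structure σ
_↾_ {σ} A P = record
  { Carrier = Σ (Carrier A) P
  ; relB    = λ R v → relB A R (λ j → Σ.proj₁ (v j))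
  ; relD    = λ E x y → relD A E (Σ.proj₁ x) (Σ.proj₁ y)
  ; relB-ext = λ R v w e → relB-ext A R _ _ (λ j → cong Σ.proj₁ (e j))
  }
  where open import Data.Product as Σ using ()

data Atom (σ : Sig) (n : ℕ) : Set where
  base : (R : BSym σ) → (Fin (arity σ R) → Fin n) → Atom σ n
  dist : DSym σ → Fin n → Fin n → Atom σ n
  eq   : Fin n → Fin n → Atom σ n

SatAtom : {σ : Sig} {n : ℕ} (A : Structure σ) → (Fin n → Carrier A) → Atom σ n → Set
SatAtom A ρ (base R v) = relB A R (ρ ∘ v)
SatAtom A ρ (dist E x y) = relD A E (ρ x) (ρ y)
SatAtom A ρ (eq x y) = ρ x ≡ ρ y

-- Quantifier-free UNFO(+EQ) formulas with free variables among Fin n: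
-- the UNFO grammar without the ∃ clause.  Unary negation ¬ψ(x) where ψ has
-- at most the variable x free is  neg ψ x  (ψ a formula in one variable,
-- instantiated by x), and ¬ψ with ψ having no free variable is  neg₀ ψ.
data QF (σ : Sig) : ℕ → Set where
  atom : {n : ℕ} → Atom σ n → QF σ n
  _∧_  : {n : ℕ} → QF σ n → QF σ n → QF σ n
  _∨_  : {n : ℕ} → QF σ n → QF σ n → QF σ n
  neg  : {n : ℕ} → QF σ 1 → Fin n → QF σ n
  neg₀ : {n : ℕ} → QF σ 0 → QF σ n

Sat : {σ : Sig} {n : ℕ} (A : Structure σ) → (Fin n → Carrier A) → QF σ n → Set
Sat A ρ (atom α) = SatAtom A ρ α
Sat A ρ (φ ∧ ψ) = Sat A ρ φ × Sat A ρ ψ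
Sat A ρ (φ ∨ ψ) = Sat A ρ φ ⊎ Sat A ρ ψ
Sat A ρ (neg ψ x) = ¬ Sat A (λ _ → ρ x) ψ
Sat A ρ (neg₀ ψ) = ¬ Sat A (λ ()) ψ

-- Scott-normal form
--   φ = ∀x₁…x_t ¬φ₀(x̄) ∧ ⋀_{i=1}^m ∀x ∃ȳ φᵢ(x,ȳ)
-- φᵢ has variables Fin (suc (k i)): variable 0 is x, variables 1..k i are ȳ.

record SNF (σ : Sig) : Set where
  field
    t    : ℕ
    φ₀   : QF σ t
    m    : ℕ
    k    : Fin m → ℕ
    φᵢ   : (i : Fin m) → QF σ (suc (k i))
open SNF public

-- satisfaction of the displayed sentence (∀x̄¬φ₀ abbreviates ¬∃x̄ φ₀)
_⊨_ : {σ : Sig} → Structure σ → SNF σ → Set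
A ⊨ φ =
  ¬ (∃ λ (xs : Fin (t φ) → Carrier A) → Sat A xs (φ₀ φ))
  × ((i : Fin (m φ)) (a : Carrier A) →
       ∃ λ (ys : Vector (Carrier A) (k φ i)) → Sat A (a ∷ ys) (φᵢ φ i))

-- A witness structure for a and φᵢ is 𝔄 ↾ {a, b̄} with 𝔄 ⊨ φᵢ(a,b̄).
-- A φ-witness structure for a is 𝔄 ↾ (W₁ ∪ ⋯ ∪ W_m) for a choice of witness
-- structures Wᵢ for a and φᵢ.  Since the structure is the induced
-- substructure on its domain, we record it by its domain W (𝔄 ↾ W).

IsφWitnessDomain : {σ : Sig} (A : Structure σ) (φ : SNF σ) (a : Carrier A)
                   (W : Carrier A → Set) → Set
IsφWitnessDomain A φ a W =
  Σ ((i : Fin (m φ)) → Vector (Carrier A) (k φ i)) λ bs →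
    ((i : Fin (m φ)) → Sat A (a ∷ bs i) (φᵢ φ i))
    × ((x : Carrier A) →
         W x ⇔ (∃ λ (i : Fin (m φ)) → x ≡ a ⊎ (∃ λ j → x ≡ bs i j)))

HasφWitnessStructure : {σ : Sig} (A : Structure σ) (φ : SNF σ) (a : Carrier A) → Set₁
HasφWitnessStructure A φ a = Σ (Carrier A → Set) (IsφWitnessDomain A φ a)

record Hom {σ : Sig} (B A : Structure σ) : Set where
  field
    fun   : Carrier B → Carrier A
    presB : (R : BSym σ) (v : Fin (arity σ R) → Carrier B) →
            relB B R v → relB A R (fun ∘ v)
    presD : (E : DSym σ) (x y : Carrier B) →
            relD B E x y → relD A E (fun x) (fun y)
open Hom public

data Literal (σ : Sig) : Set where
  pos : Atom σ 1 → Literal σ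
  ng  : Atom σ 1 → Literal σ

SatLit : {σ : Sig} (A : Structure σ) → Carrier A → Literal σ → Set
SatLit A a (pos α) = SatAtom A (λ _ → a) α
SatLit A a (ng α) = ¬ SatAtom A (λ _ → a) α

Preserves1Types : {σ : Sig} {B A : Structure σ} → Hom B A → Set
Preserves1Types {σ} {B} {A} h =
  (b : Carrier B) (L : Literal σ) → SatLit B b L ⇔ SatLit A (fun h b) L

TupleSet : {σ : Sig} (A : Structure σ) {t : ℕ} → (Fin t → Carrier A) → Carrier A → Set
TupleSet A as x = ∃ λ j → x ≡ as j

-- A universal sentence ∀x̄ ¬φ₀ is reflected along any map that is a homomorphism
-- on the relevant tuple and preserves atomic 1-types: in UNFO negation is only
-- applied to formulas in one free variable, whose truth is fixed by the 1-type,
-- so positive atoms travel forward along the homomorphism and negated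
-- subformulas travel backward along the 1-type.  The ∀∃-conjuncts hold in 𝔄'
-- outright, since every element has a φ-witness structure.
module Submission where

open import Defs
open import Data.Nat using (ℕ; zero; suc)
open import Data.Fin using (Fin; zero; suc; fromℕ<)
open import Data.Product using (Σ; ∃; _,_; proj₁)
open import Data.Product.Function.NonDependent.Propositional using (_×-⇔_)
open import Data.Sum using (inj₁; inj₂)
open import Data.Sum.Function.Propositional using (_⊎-⇔_)
open import Data.Empty using (⊥-elim)
open import Relation.Nullary using (¬_; Dec; yes; no)
open import Relation.Nullary.Decidable using (¬¬-excluded-middle)
open import Relation.Binary.PropositionalEquality
  using (_≡_; refl; sym; trans; cong; subst; subst₂)
open import Function using (_∘_)
open import Data.Vec.Functional using (Vector; _∷_)
open import Function.Bundles using (_⇔_; mk⇔; Equivalence)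
open import Function.Construct.Identity using (⇔-id)
open import Function.Related.TypeIsomorphisms using (¬-cong-⇔)

record Representatives {X : Set} {t : ℕ} (xs : Fin t → X) : Set where
  field
    rep          : Fin t → Fin t
    rep-sound    : ∀ i → xs (rep i) ≡ xs i
    rep-respects : ∀ i j → xs i ≡ xs j → rep i ≡ rep j

-- Equality on X is not decidable, so the representatives exist only up to
-- double negation; one instance of excluded middle per element suffices.
¬¬-representatives : {X : Set} {t : ℕ} (xs : Fin t → X) → ¬ ¬ Representatives xs
¬¬-representatives {t = zero} xs k =
  k (record { rep = λ () ; rep-sound = λ () ; rep-respects = λ () })
¬¬-representatives {t = suc t} xs k =
  ¬¬-representatives (xs ∘ suc) λ R →
  ¬¬-excluded-middle λ d → k (extend R d)
  where
  extend : Representatives (xs ∘ suc) → Dec (∃ λ i → xs zero ≡ xs (suc i)) →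
           Representatives xs
  extend R (yes (i₀ , x₀≡xᵢ₀)) = record
    { rep = λ { zero → suc (rep i₀) ; (suc i) → suc (rep i) }
    ; rep-sound = λ { zero → trans (rep-sound i₀) (sym x₀≡xᵢ₀)
                    ; (suc i) → rep-sound i }
    ; rep-respects = λ
      { zero zero _ → refl
      ; zero (suc j) e → cong suc (rep-respects i₀ j (trans (sym x₀≡xᵢ₀) e))
      ; (suc i) zero e → cong suc (rep-respects i i₀ (trans e x₀≡xᵢ₀))
      ; (suc i) (suc j) e → cong suc (rep-respects i j e)
      }
    }
    where open Representatives R
  extend R (no x₀∉xs) = record
    { rep = λ { zero → zero ; (suc i) → suc (rep i) }
    ; rep-sound = λ { zero → refl ; (suc i) → rep-sound i }
    ; rep-respects = λ
      { zero zero _ → refl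
      ; zero (suc j) e → ⊥-elim (x₀∉xs (j , e))
      ; (suc i) zero e → ⊥-elim (x₀∉xs (i , sym e))
      ; (suc i) (suc j) e → cong suc (rep-respects i j e)
      }
    }
    where open Representatives R

module _ {σ : Sig} where

  -- Every atom mentions a variable (symbols have positive arity), so there are
  -- no quantifier-free formulas without free variables.
  ¬QF₀ : ¬ QF σ 0
  ¬QF₀ (atom (base R v)) with () ← v (fromℕ< (arity-pos σ R))
  ¬QF₀ (φ ∧ _) = ¬QF₀ φ
  ¬QF₀ (φ ∨ _) = ¬QF₀ φ
  ¬QF₀ (neg₀ φ) = ¬QF₀ φ

  Sat₁-invariant : {B A : Structure σ} (h : Hom B A) → Preserves1Types h →
                   (ψ : QF σ 1) (b : Carrier B) →
                   Sat B (λ _ → b) ψ ⇔ Sat A (λ _ → fun h b) ψ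
  Sat₁-invariant h h-1types (atom α) b = h-1types b (pos α)
  Sat₁-invariant h h-1types (φ ∧ ψ) b =
    Sat₁-invariant h h-1types φ b ×-⇔ Sat₁-invariant h h-1types ψ b
  Sat₁-invariant h h-1types (φ ∨ ψ) b =
    Sat₁-invariant h h-1types φ b ⊎-⇔ Sat₁-invariant h h-1types ψ b
  Sat₁-invariant h h-1types (neg ψ _) b = ¬-cong-⇔ (Sat₁-invariant h h-1types ψ b)
  Sat₁-invariant h h-1types (neg₀ ψ) b = ⊥-elim (¬QF₀ ψ)

  inclusion : (A : Structure σ) (P : Carrier A → Set) → Hom (A ↾ P) A
  inclusion A P = record
    { fun = proj₁ ; presB = λ _ _ r → r ; presD = λ _ _ _ r → r }

  inclusion-preserves1Types : (A : Structure σ) (P : Carrier A → Set) →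
                              Preserves1Types (inclusion A P)
  inclusion-preserves1Types A P b (pos α) = atom-preserved α
    where
    atom-preserved : (α : Atom σ 1) →
                     SatAtom (A ↾ P) (λ _ → b) α ⇔ SatAtom A (λ _ → proj₁ b) α
    atom-preserved (base R v) = ⇔-id _
    atom-preserved (dist E x y) = ⇔-id _
    atom-preserved (eq x y) = mk⇔ (λ _ → refl) (λ _ → refl)
  inclusion-preserves1Types A P b (ng α) =
    ¬-cong-⇔ (inclusion-preserves1Types A P b (pos α))

  -- Lifts of equal elements must coincide: the membership proofs in 𝔄' ↾ P
  -- may differ, and equality atoms are transferred through τ.
  Sat-transfer : {A' A : Structure σ} {P : Carrier A' → Set}
                 (h : Hom (A' ↾ P) A) → Preserves1Types h →
                 {n : ℕ} (ρ : Fin n → Carrier A') (τ : Fin n → Carrier (A' ↾ P)) →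
                 (∀ x → proj₁ (τ x) ≡ ρ x) →
                 (∀ x y → ρ x ≡ ρ y → τ x ≡ τ y) →
                 (ψ : QF σ n) → Sat A' ρ ψ → Sat A (fun h ∘ τ) ψ
  Sat-transfer {A'} h _ ρ τ lifts _ (atom (base R v)) r =
    presB h R (τ ∘ v) (relB-ext A' R _ _ (λ j → sym (lifts (v j))) r)
  Sat-transfer {A'} h _ ρ τ lifts _ (atom (dist E x y)) r =
    presD h E (τ x) (τ y) (subst₂ (relD A' E) (sym (lifts x)) (sym (lifts y)) r)
  Sat-transfer h _ ρ τ _ coherent (atom (eq x y)) e = cong (fun h) (coherent x y e)
  Sat-transfer h h-1types ρ τ lifts coherent (φ ∧ ψ) (s , s') =
    Sat-transfer h h-1types ρ τ lifts coherent φ s ,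
    Sat-transfer h h-1types ρ τ lifts coherent ψ s'
  Sat-transfer h h-1types ρ τ lifts coherent (φ ∨ ψ) (inj₁ s) =
    inj₁ (Sat-transfer h h-1types ρ τ lifts coherent φ s)
  Sat-transfer h h-1types ρ τ lifts coherent (φ ∨ ψ) (inj₂ s) =
    inj₂ (Sat-transfer h h-1types ρ τ lifts coherent ψ s)
  Sat-transfer {A'} {P = P} h h-1types ρ τ lifts _ (neg ψ x) ¬ψ[ρx] ψ[hτx] =
    ¬ψ[ρx] (subst (λ a → Sat A' (λ _ → a) ψ) (lifts x) ψ[τx])
    where
    ψ[τx] : Sat A' (λ _ → proj₁ (τ x)) ψ
    ψ[τx] = Equivalence.to
      (Sat₁-invariant (inclusion A' P) (inclusion-preserves1Types A' P) ψ (τ x))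
      (Equivalence.from (Sat₁-invariant h h-1types ψ (τ x)) ψ[hτx])
  Sat-transfer h _ ρ τ _ _ (neg₀ ψ) _ = ⊥-elim (¬QF₀ ψ)

lemma3 : {σ : Sig} (φ : SNF σ) (A A' : Structure σ) →
    Admissible A → A ⊨ φ →
    Admissible A' →
    ((a' : Carrier A') → HasφWitnessStructure A' φ a') →
    ((as' : Fin (t φ) → Carrier A') →
    Σ (Hom (A' ↾ TupleSet A' as') A) Preserves1Types) →
    A' ⊨ φ
lemma3 φ A A' _ (A⊭φ₀ , _) _ witnesses homs = A'⊭φ₀ , A'⊨φᵢ
  where
  A'⊨φᵢ : (i : Fin (m φ)) (a : Carrier A') →
          ∃ λ (ys : Vector (Carrier A') (k φ i)) → Sat A' (a ∷ ys) (φᵢ φ i)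
  A'⊨φᵢ i a with _ , bs , bs-witness , _ ← witnesses a = bs i , bs-witness i

  A'⊭φ₀ : ¬ (∃ λ (xs : Fin (t φ) → Carrier A') → Sat A' xs (φ₀ φ))
  A'⊭φ₀ (xs , φ₀[xs]) = ¬¬-representatives xs λ R →
    let open Representatives R
        h , h-1types = homs xs
        member : Fin (t φ) → Carrier (A' ↾ TupleSet A' xs)
        member r = xs r , r , refl
    in A⊭φ₀ (fun h ∘ member ∘ rep ,
             Sat-transfer h h-1types xs (member ∘ rep) rep-sound
               (λ i j e → cong member (rep-respects i j e)) (φ₀ φ) φ₀[xs])
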